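{- Let $T$ be a tree on a finite set $I$. The map $\Pi$ from the interval $[\hat 0, T]$ of $\operatorname{For}(I)$ to the set $\operatorname{Ad}(T)$ of $T$-admissible partitions of $I$ ordered by refinement, sending a forest $F=T_1\sqcup\dots\sqcup T_k$ (each $T_i$ a tree) to the partition $(\mathcal L(T_1),\dots,\mathcal L(T_k))$, is an isomorphism of posets.
   Context: A tree on a finite set $I$ is a rooted binary tree (not considered as planar) whose leaves are bijectively labeled by $I$: every vertex is either an inner vertex of valence 3, or a vertex of valence 1 (a leaf or the root); edges are oriented towards the root. A forest on $I$ is a set of trees on pairwise disjoint label sets whose union is $I$. For a forest $F$, $\mathcal V(F)$ is its set of inner vertices and $\mathcal L(F)$ its set of leaves. For forests $F,G$ on $I$, $F\le G$ means there is a continuous map from $F$ to $G$ (forests viewed as 1-dimensional complexes) such that: (D1) it is increasing with respect to the orientation towards the root; (D2) it maps inner vertices to inner vertices injectively; (D3) it restricts to the identity of $I$ on leaves; (D4) its restriction to each tree of $F$ is injective. $\operatorname{For}(I)$ is the set of forests on $I$ with this partial order; its minimum $\hat 0$ is the forest with no inner vertices. For distinct leaves $i,j$ of the tree $T$, $v_{(i,j)}$ is the inner vertex of $T$ at which the paths from $i$ and from $j$ to the root meet. For $J\subseteq I$, $\mathcal S(J)=\{v_{(i,j)} : i\neq j\in J\}$. A partition $(\pi_1,\dots,\pi_k)$ of $I$ is $T$-admissible if $\mathcal S(\pi_i)\cap\mathcal S(\pi_j)=\emptyset$ for all $i\neq j$. $\operatorname{Ad}(T)$ is ordered by refinement: $\pi\le_r\tau$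 iff each block of $\pi$ is contained in some block of $\tau$. -}

module Defs where

open import Data.Nat using (ℕ; _≤_)
open import Data.Fin using (Fin)
open import Data.List using (List; []; _∷_; _++_; concat; map; length; lookup; allFin)
open import Data.List.Membership.Propositional using (_∈_)
open import Data.List.Relation.Unary.All using (All)
open import Data.List.Relation.Unary.Any using (Any)
open import Data.List.Relation.Binary.Permutation.Propositional using (_↭_)
open import Data.Maybe using (Maybe; just; nothing)
open import Data.Product using (Σ; _×_; _,_; ∃)
open import Data.Sum using (_⊎_)
open import Data.Unit using (⊤)
open import Data.Empty using (⊥)
open import Relation.Binary.PropositionalEquality using (_≡_; _≢_)

-- The finite set I is modelled as Fin n.  The inductive
-- representation is planar; non-planarity is handled by the fact that
-- every notion below (order, Π, admissibility) is invariant under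
-- swapping children / reordering the trees of a forest.
-- A tree  leaf i  is the single edge from leaf i to the root;
-- node l r  has an inner vertex whose outgoing edge goes to the root
-- (or to the parent vertex when it is a subtree).

data Tree (n : ℕ) : Set where
  leaf : Fin n → Tree n
  node : Tree n → Tree n → Tree n

module _ {n : ℕ} where

  leaves : Tree n → List (Fin n)
  leaves (leaf i)   = i ∷ []
  leaves (node l r) = leaves l ++ leaves r

  -- non-root vertices of a tree (leaves and inner vertices);
  -- top is the topmost one (the one adjacent to the root)
  data Vtx : Tree n → Set where
    top : ∀ {t} → Vtx t
    inL : ∀ {l r} → Vtx l → Vtx (node l r)
    inR : ∀ {l r} → Vtx r → Vtx (node l r)

  data V (t : Tree n) : Set where
    rootV : V t
    sub   : Vtx t → V t

  parent : ∀ {t} → Vtx t → V t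
  parent top = rootV
  parent (inL v) with parent v
  ... | rootV = sub top
  ... | sub w = sub (inL w)
  parent (inR v) with parent v
  ... | rootV = sub top
  ... | sub w = sub (inR w)

  labelVtx : ∀ {t} → Vtx t → Maybe (Fin n)
  labelVtx {leaf i}   top = just i
  labelVtx {node l r} top = nothing
  labelVtx (inL v) = labelVtx v
  labelVtx (inR v) = labelVtx v

  IsInner : ∀ {t} → Vtx t → Set
  IsInner {leaf i}   top = ⊥
  IsInner {node l r} top = ⊤
  IsInner (inL v) = IsInner v
  IsInner (inR v) = IsInner v

  -- v ≼ w : w lies on the path from v to the root (ancestor-or-self)
  _≼_ : ∀ {t} → Vtx t → Vtx t → Set
  v ≼ top = ⊤
  top ≼ inL w = ⊥
  top ≼ inR w = ⊥
  inL v ≼ inL w = v ≼ w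
  inR v ≼ inR w = v ≼ w
  inL v ≼ inR w = ⊥
  inR v ≼ inL w = ⊥

  -- Cells of the geometric realisation of a tree (as a 1-dimensional
  -- complex): the vertices, and each open edge (from v to parent v)
  -- cut into three open cells: lower half, midpoint, upper half.
  data Cell (t : Tree n) : Set where
    pt  : V t → Cell t
    lo  : Vtx t → Cell t
    mid : Vtx t → Cell t
    hi  : Vtx t → Cell t

  -- the cells a continuous map may send a vertex to (up to
  -- reparametrisation of edges): vertices, or an interior point of an edge
  IsPointCell : ∀ {t} → Cell t → Set
  IsPointCell (pt _)  = ⊤
  IsPointCell (lo _)  = ⊥
  IsPointCell (mid _) = ⊤
  IsPointCell (hi _)  = ⊥

  private
    cellKey : ∀ {t} → Cell t → Maybe (Σ (Vtx t) (λ _ → ℕ))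
    cellKey (pt rootV)   = nothing
    cellKey (pt (sub v)) = just (v , 0)
    cellKey (lo v)       = just (v , 1)
    cellKey (mid v)      = just (v , 2)
    cellKey (hi v)       = just (v , 3)

    keyLe : ∀ {t} → Maybe (Σ (Vtx t) (λ _ → ℕ)) → Maybe (Σ (Vtx t) (λ _ → ℕ)) → Set
    keyLe _ nothing = ⊤
    keyLe nothing (just _) = ⊥
    keyLe (just (v , i)) (just (w , j)) = (v ≡ w × i ≤ j) ⊎ (v ≼ w × v ≢ w)

  -- the orientation order (towards the root) on the cells of a tree
  _≤c_ : ∀ {t} → Cell t → Cell t → Set
  c ≤c d = keyLe (cellKey c) (cellKey d)

  -- Forests: lists of trees (order irrelevant).
  Forest : Set
  Forest = List (Tree n)

  IsTreeOn : Tree n → Set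
  IsTreeOn t = leaves t ↭ allFin n

  -- leaf sets pairwise disjoint, union = I, labelling bijective
  IsForestOn : Forest → Set
  IsForestOn F = concat (map leaves F) ↭ allFin n

  Point : Forest → Set
  Point G = Σ (Fin (length G)) (λ k → Cell (lookup G k))

  data PLe (G : Forest) : Point G → Point G → Set where
    same : ∀ {k c d} → c ≤c d → PLe G (k , c) (k , d)

  PLt : (G : Forest) → Point G → Point G → Set
  PLt G p q = PLe G p q × p ≢ q

  ptLabel : (G : Forest) → Point G → Maybe (Fin n)
  ptLabel G (k , pt (sub v)) = labelVtx v
  ptLabel G (k , _) = nothing

  InnerPt : (G : Forest) → Point G → Set
  InnerPt G (k , pt (sub v)) = IsInner v
  InnerPt G (k , _) = ⊥

  data SCell (t : Tree n) : Set where
    vert : V t → SCell t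
    edge : Vtx t → SCell t   -- the open edge from v to parent v

  -- A continuous map F → G increasing w.r.t. the orientation, described
  -- by the images of the vertices; each (oriented) edge u → parent u is
  -- sent monotonically onto the upward path from φ u to φ (parent u).
  -- image of a cell of the a-th tree of F under the map with vertex data φ
  Img : (F G : Forest) → ((a : Fin (length F)) → V (lookup F a) → Point G) →
        (a : Fin (length F)) → SCell (lookup F a) → Point G → Set
  Img F G φ a (vert x) p = φ a x ≡ p
  Img F G φ a (edge v) p = PLt G (φ a (sub v)) p × PLt G p (φ a (parent v))

  record _≤F_ (F G : Forest) : Set where
    field
      φ     : (a : Fin (length F)) → V (lookup F a) → Point G
      φ-pt  : ∀ a x → IsPointCell (Data.Product.proj₂ (φ a x))
      -- (D1) increasing (continuity: edges go to upward paths)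
      D1    : ∀ a (v : Vtx (lookup F a)) → PLe G (φ a (sub v)) (φ a (parent v))
      D2-in : ∀ a (v : Vtx (lookup F a)) → IsInner v → InnerPt G (φ a (sub v))
      D2-inj : ∀ a b (v : Vtx (lookup F a)) (w : Vtx (lookup F b)) →
               IsInner v → IsInner w → φ a (sub v) ≡ φ b (sub w) →
               _≡_ {A = Σ (Fin (length F)) (λ c → Vtx (lookup F c))} (a , v) (b , w)
      D3    : ∀ a (v : Vtx (lookup F a)) i → labelVtx v ≡ just i → ptLabel G (φ a (sub v)) ≡ just i
      D4    : ∀ a (x y : SCell (lookup F a)) (p : Point G) →
              Img F G φ a x p → Img F G φ a y p → x ≡ y

  Π : Forest → List (List (Fin n))
  Π F = map leaves F

  data IsMeet : (t : Tree n) → Vtx t → Fin n → Fin n → Set where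
    hereLR : ∀ {l r i j} → i ∈ leaves l → j ∈ leaves r → IsMeet (node l r) top i j
    hereRL : ∀ {l r i j} → i ∈ leaves r → j ∈ leaves l → IsMeet (node l r) top i j
    goL : ∀ {l r v i j} → IsMeet l v i j → IsMeet (node l r) (inL v) i j
    goR : ∀ {l r v i j} → IsMeet r v i j → IsMeet (node l r) (inR v) i j

  InS : (t : Tree n) → Vtx t → List (Fin n) → Set
  InS t v J = ∃ λ i → ∃ λ j → i ∈ J × j ∈ J × i ≢ j × IsMeet t v i j

  NonEmpty : List (Fin n) → Set
  NonEmpty B = ∃ λ x → x ∈ B

  IsPartition : List (List (Fin n)) → Set
  IsPartition π = (concat π ↭ allFin n) × All NonEmpty π

  Admissible : Tree n → List (List (Fin n)) → Set
  Admissible t π = IsPartition π ×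
    (∀ (a b : Fin (length π)) → a ≢ b → ∀ (v : Vtx t) →
       InS t v (lookup π a) → InS t v (lookup π b) → ⊥)

  _⊆_ : List (Fin n) → List (Fin n) → Set
  A ⊆ B = ∀ {x} → x ∈ A → x ∈ B

  _≤r_ : List (List (Fin n)) → List (List (Fin n)) → Set
  π ≤r τ = All (λ A → Any (λ B → A ⊆ B) τ) π

-- A forest lies below T exactly when each of its trees embeds into T (vertices to vertices, edges
-- onto paths, labels fixed) with inner vertices of different trees landing on different vertices.
-- Indeed a map obeying (D1)–(D4) is such an embedding: at an inner vertex, the two incoming edges
-- must arrive through different child edges of its image, or (D4) fails at a midpoint.
-- An embedding sends the meet of leaves i, j to the meet v_(i,j) of T, so distinct trees of F have
-- disjoint sets 𝒮 and Π F is admissible; conversely, restricting T to the blocks of an admissible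
-- partition gives a forest below T. As the labels of T are distinct, an embedding t ↪ T factors
-- through u ↪ T once the leaves of t lie among those of u, so Π reflects the order; it preserves it
-- since a map F → G sends each tree of F into a single tree of G.

{-# OPTIONS --safe #-}
module Submission where

open import Defs
open import Data.Empty using (⊥; ⊥-elim)
open import Data.Fin using (Fin) renaming (zero to fz; suc to fs)
import Data.Fin.Properties as Fin
open import Data.List using (List; []; _∷_; _++_; concat; map; length; lookup; allFin)
open import Data.List.Membership.Propositional using (_∈_; lose)
open import Data.List.Membership.Propositional.Properties using (∈-++⁺ˡ; ∈-++⁺ʳ; ∈-++⁻; ∈-map⁺; ∈-lookup; ∈-allFin)
open import Data.List.Membership.Propositional.Properties.WithK using (unique∧set⇒bag)
open import Data.List.Relation.Binary.BagAndSetEquality using (∼bag⇒↭)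
open import Data.List.Relation.Binary.Disjoint.Propositional using (Disjoint)
open import Data.List.Relation.Binary.Disjoint.Propositional.Properties using () renaming (sym to Disjoint-sym)
open import Data.List.Relation.Binary.Permutation.Propositional using (_↭_; ↭-refl; ↭-sym; ↭-trans; ↭⇒↭ₛ)
open import Data.List.Relation.Binary.Permutation.Propositional.Properties using (∈-resp-↭) renaming (++⁺ to ↭-++⁺)
open import Data.List.Relation.Unary.All using (All; []; _∷_)
import Data.List.Relation.Unary.All as All
import Data.List.Relation.Unary.All.Properties as Allₚ
open import Data.List.Relation.Unary.Any using (Any; here; there)
import Data.List.Relation.Unary.Any as Any
import Data.List.Relation.Unary.Any.Properties as Anyₚ
open import Data.List.Relation.Unary.Unique.Propositional using (Unique; []; _∷_)
import Data.List.Relation.Unary.Unique.Propositional.Properties as Uniqueₚ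
open import Data.Maybe using (Maybe; just; nothing)
open import Data.Nat using (ℕ; z≤n)
open import Data.Product using (_×_; ∃; Σ; _,_; proj₁; proj₂)
open import Data.Product.Properties.WithK using (,-injectiveʳ)
open import Data.Sum using (inj₁; inj₂; [_,_]′)
open import Data.Unit using (⊤; tt)
open import Function using (_∘_)
open import Function.Bundles using (mk⇔)
open import Relation.Binary.PropositionalEquality
open import Relation.Nullary using (¬_; Dec; yes; no)

module _ {A B : Set} (f : A → B) where

  mapIndex : (xs : List A) → Fin (length (map f xs)) → Fin (length xs)
  mapIndex (x ∷ xs) fz     = fz
  mapIndex (x ∷ xs) (fs i) = fs (mapIndex xs i)

  lookup-map : (xs : List A) (i : Fin (length (map f xs))) → lookup (map f xs) i ≡ f (lookup xs (mapIndex xs i))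
  lookup-map (x ∷ xs) fz     = refl
  lookup-map (x ∷ xs) (fs i) = lookup-map xs i

  mapIndex-injective : (xs : List A) {i j : Fin (length (map f xs))} → mapIndex xs i ≡ mapIndex xs j → i ≡ j
  mapIndex-injective (x ∷ xs) {fz}   {fz}   _  = refl
  mapIndex-injective (x ∷ xs) {fs i} {fs j} eq = cong fs (mapIndex-injective xs (Fin.suc-injective eq))
  mapIndex-injective (x ∷ xs) {fz}   {fs j} ()
  mapIndex-injective (x ∷ xs) {fs i} {fz}   ()

Unique-++⁻ : ∀ {A : Set} (xs : List A) {ys : List A} → Unique (xs ++ ys) → Unique xs × Unique ys × Disjoint xs ys
Unique-++⁻ []       u                = [] , u , λ ()
Unique-++⁻ (x ∷ xs) (x∉xs++ys ∷ u) with u-xs , u-ys , xs#ys ← Unique-++⁻ xs u =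
  All.tabulate (λ y∈xs → All.lookup x∉xs++ys (∈-++⁺ˡ y∈xs)) ∷ u-xs , u-ys , x∷xs#ys
  where
  x∷xs#ys : Disjoint (x ∷ xs) _
  x∷xs#ys (here refl , x∈ys) = All.lookup x∉xs++ys (∈-++⁺ʳ xs x∈ys) refl
  x∷xs#ys (there y∈xs , y∈ys) = xs#ys (y∈xs , y∈ys)

module _ {n : ℕ} where

  open import Data.List.Membership.DecPropositional (Fin._≟_ {n}) using (_∈?_)
  open import Data.List.Relation.Binary.Permutation.Setoid.Properties (setoid (Fin n)) using (Unique-resp-↭)

  _≺_ : ∀ {t : Tree n} → Vtx t → Vtx t → Set
  v ≺ w = v ≼ w × v ≢ w

  ≼-refl : ∀ {t : Tree n} (v : Vtx t) → v ≼ v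
  ≼-refl top     = tt
  ≼-refl (inL v) = ≼-refl v
  ≼-refl (inR v) = ≼-refl v

  ≼-trans : ∀ {t : Tree n} (u v w : Vtx t) → u ≼ v → v ≼ w → u ≼ w
  ≼-trans u       v       top     p q = tt
  ≼-trans u       top     (inL w) p ()
  ≼-trans u       (inR v) (inL w) p ()
  ≼-trans top     (inL v) (inL w) () q
  ≼-trans (inR u) (inL v) (inL w) () q
  ≼-trans (inL u) (inL v) (inL w) p q = ≼-trans u v w p q
  ≼-trans u       top     (inR w) p ()
  ≼-trans u       (inL v) (inR w) p ()
  ≼-trans top     (inR v) (inR w) () q
  ≼-trans (inL u) (inR v) (inR w) () q
  ≼-trans (inR u) (inR v) (inR w) p q = ≼-trans u v w p q

  ≼-antisym : ∀ {t : Tree n} (u v : Vtx t) → u ≼ v → v ≼ u → u ≡ v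
  ≼-antisym top     top     p q = refl
  ≼-antisym top     (inL v) () q
  ≼-antisym top     (inR v) () q
  ≼-antisym (inL u) top     p ()
  ≼-antisym (inR u) top     p ()
  ≼-antisym (inL u) (inL v) p q = cong inL (≼-antisym u v p q)
  ≼-antisym (inR u) (inR v) p q = cong inR (≼-antisym u v p q)
  ≼-antisym (inL u) (inR v) () q
  ≼-antisym (inR u) (inL v) () q

  inL-injective : ∀ {l r : Tree n} {u v : Vtx l} → inL {r = r} u ≡ inL v → u ≡ v
  inL-injective refl = refl

  inR-injective : ∀ {l r : Tree n} {u v : Vtx r} → inR {l = l} u ≡ inR v → u ≡ v
  inR-injective refl = refl

  _≟ᵥ_ : ∀ {t : Tree n} (u v : Vtx t) → Dec (u ≡ v)
  top   ≟ᵥ top   = yes refl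
  top   ≟ᵥ inL v = no λ ()
  top   ≟ᵥ inR v = no λ ()
  inL u ≟ᵥ top   = no λ ()
  inR u ≟ᵥ top   = no λ ()
  inL u ≟ᵥ inR v = no λ ()
  inR u ≟ᵥ inL v = no λ ()
  inL u ≟ᵥ inL v with u ≟ᵥ v
  ... | yes refl = yes refl
  ... | no u≢v   = no λ e → u≢v (inL-injective e)
  inR u ≟ᵥ inR v with u ≟ᵥ v
  ... | yes refl = yes refl
  ... | no u≢v   = no λ e → u≢v (inR-injective e)

  liftL : ∀ {l r : Tree n} → V l → V (node l r)
  liftL rootV   = sub top
  liftL (sub w) = sub (inL w)

  liftR : ∀ {l r : Tree n} → V r → V (node l r)
  liftR rootV   = sub top
  liftR (sub w) = sub (inR w)

  liftL-injective : ∀ {l r : Tree n} {x y : V l} → liftL {r = r} x ≡ liftL y → x ≡ y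
  liftL-injective {x = rootV} {rootV} _    = refl
  liftL-injective {x = sub u} {sub v} refl = refl

  liftR-injective : ∀ {l r : Tree n} {x y : V r} → liftR {l = l} x ≡ liftR y → x ≡ y
  liftR-injective {x = rootV} {rootV} _    = refl
  liftR-injective {x = sub u} {sub v} refl = refl

  parent-inL : ∀ {l r : Tree n} (v : Vtx l) → parent (inL {r = r} v) ≡ liftL (parent v)
  parent-inL v with parent v
  ... | rootV = refl
  ... | sub w = refl

  parent-inR : ∀ {l r : Tree n} (v : Vtx r) → parent (inR {l = l} v) ≡ liftR (parent v)
  parent-inR v with parent v
  ... | rootV = refl
  ... | sub w = refl

  ¬top≺ : ∀ {t : Tree n} (w : Vtx t) → ¬ top ≺ w
  ¬top≺ top     (_ , ne) = ne refl
  ¬top≺ (inL w) (() , _)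
  ¬top≺ (inR w) (() , _)

  inL-≺ : ∀ {l r : Tree n} {u v : Vtx l} → u ≺ v → inL {r = r} u ≺ inL v
  inL-≺ (u≼v , u≢v) = u≼v , λ e → u≢v (inL-injective e)

  inR-≺ : ∀ {l r : Tree n} {u v : Vtx r} → u ≺ v → inR {l = l} u ≺ inR v
  inR-≺ (u≼v , u≢v) = u≼v , λ e → u≢v (inR-injective e)

  inL-≺⁻ : ∀ {l r : Tree n} {u v : Vtx l} → inL {r = r} u ≺ inL v → u ≺ v
  inL-≺⁻ (u≼v , u≢v) = u≼v , λ e → u≢v (cong inL e)

  inR-≺⁻ : ∀ {l r : Tree n} {u v : Vtx r} → inR {l = l} u ≺ inR v → u ≺ v
  inR-≺⁻ (u≼v , u≢v) = u≼v , λ e → u≢v (cong inR e)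

  parent-≻ : ∀ {t : Tree n} (v : Vtx t) {w : Vtx t} → parent v ≡ sub w → v ≺ w
  parent-≻ top ()
  parent-≻ (inL v) eq with parent v | parent-≻ v
  ... | rootV | _ with refl ← eq = tt , λ ()
  ... | sub _ | v≺w with refl ← eq = inL-≺ (v≺w refl)
  parent-≻ (inR v) eq with parent v | parent-≻ v
  ... | rootV | _ with refl ← eq = tt , λ ()
  ... | sub _ | v≺w with refl ← eq = inR-≺ (v≺w refl)

  ≺⇒parent-≼ : ∀ {t : Tree n} (v c : Vtx t) → v ≺ c → ∃ λ w → parent v ≡ sub w × w ≼ c
  ≺⇒parent-≼ top     top     (_ , v≢c) = ⊥-elim (v≢c refl)
  ≺⇒parent-≼ top     (inL c) (() , _)
  ≺⇒parent-≼ top     (inR c) (() , _)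
  ≺⇒parent-≼ (inL v) (inR c) (() , _)
  ≺⇒parent-≼ (inR v) (inL c) (() , _)
  ≺⇒parent-≼ (inL v) top     _ with parent v
  ... | rootV = top , refl , tt
  ... | sub w = inL w , refl , tt
  ≺⇒parent-≼ (inR v) top     _ with parent v
  ... | rootV = top , refl , tt
  ... | sub w = inR w , refl , tt
  ≺⇒parent-≼ (inL v) (inL c) v≺c with ≺⇒parent-≼ v c (inL-≺⁻ v≺c)
  ... | w , e , w≼c = inL w , trans (parent-inL v) (cong liftL e) , w≼c
  ≺⇒parent-≼ (inR v) (inR c) v≺c with ≺⇒parent-≼ v c (inR-≺⁻ v≺c)
  ... | w , e , w≼c = inR w , trans (parent-inR v) (cong liftR e) , w≼c

  fromRoot-induction : ∀ {t : Tree n} (P : V t → Set) → P rootV → (∀ v → P (parent v) → P (sub v)) →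
                       ∀ v → P (sub v)
  fromRoot-induction P root step top = step top root
  fromRoot-induction {node l r} P root step (inL v) =
    fromRoot-induction (P ∘ liftL) (step top root) (λ v' h → step (inL v') (subst P (sym (parent-inL v')) h)) v
  fromRoot-induction {node l r} P root step (inR v) =
    fromRoot-induction (P ∘ liftR) (step top root) (λ v' h → step (inR v') (subst P (sym (parent-inR v')) h)) v

  cellVtx : ∀ {s : Tree n} → Cell s → Maybe (Vtx s)
  cellVtx (pt rootV)   = nothing
  cellVtx (pt (sub v)) = just v
  cellVtx (lo v)       = just v
  cellVtx (mid v)      = just v
  cellVtx (hi v)       = just v

  _<c_ : ∀ {s : Tree n} → Cell s → Cell s → Set
  p <c q = p ≤c q × p ≢ q

  root-maximal : ∀ {s : Tree n} (q : Cell s) → ¬ (pt rootV <c q)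
  root-maximal (pt rootV)   (_ , ne) = ne refl
  root-maximal (pt (sub v)) (() , _)
  root-maximal (lo v)       (() , _)
  root-maximal (mid v)      (() , _)
  root-maximal (hi v)       (() , _)

  <c⇒cellVtx : ∀ {s : Tree n} (p : Cell s) {q : Cell s} → p <c q → ∃ λ k → cellVtx p ≡ just k
  <c⇒cellVtx (pt rootV)   p<q = ⊥-elim (root-maximal _ p<q)
  <c⇒cellVtx (pt (sub v)) _   = v , refl
  <c⇒cellVtx (lo v)       _   = v , refl
  <c⇒cellVtx (mid v)      _   = v , refl
  <c⇒cellVtx (hi v)       _   = v , refl

  vertex≤c⇒≼ : ∀ {s : Tree n} {a k : Vtx s} (p : Cell s) → pt (sub a) ≤c p → cellVtx p ≡ just k → a ≼ k
  vertex≤c⇒≼ (pt rootV)   _ ()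
  vertex≤c⇒≼ (pt (sub v)) (inj₁ (refl , _)) refl = ≼-refl v
  vertex≤c⇒≼ (pt (sub v)) (inj₂ (a≺v , _))  refl = a≺v
  vertex≤c⇒≼ (lo v)       (inj₁ (refl , _)) refl = ≼-refl v
  vertex≤c⇒≼ (lo v)       (inj₂ (a≺v , _))  refl = a≺v
  vertex≤c⇒≼ (mid v)      (inj₁ (refl , _)) refl = ≼-refl v
  vertex≤c⇒≼ (mid v)      (inj₂ (a≺v , _))  refl = a≺v
  vertex≤c⇒≼ (hi v)       (inj₁ (refl , _)) refl = ≼-refl v
  vertex≤c⇒≼ (hi v)       (inj₂ (a≺v , _))  refl = a≺v

  <c-vertex⇒≺ : ∀ {s : Tree n} {b k : Vtx s} (p : Cell s) → p <c pt (sub b) → cellVtx p ≡ just k → k ≺ b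
  <c-vertex⇒≺ (pt rootV)   _ ()
  <c-vertex⇒≺ (pt (sub v)) (inj₁ (refl , _) , ne) refl = ⊥-elim (ne refl)
  <c-vertex⇒≺ (pt (sub v)) (inj₂ v≺b , _)          refl = v≺b
  <c-vertex⇒≺ (lo v)       (inj₁ (refl , ()) , _)  refl
  <c-vertex⇒≺ (lo v)       (inj₂ v≺b , _)          refl = v≺b
  <c-vertex⇒≺ (mid v)      (inj₁ (refl , ()) , _)  refl
  <c-vertex⇒≺ (mid v)      (inj₂ v≺b , _)          refl = v≺b
  <c-vertex⇒≺ (hi v)       (inj₁ (refl , ()) , _)  refl
  <c-vertex⇒≺ (hi v)       (inj₂ v≺b , _)          refl = v≺b

  vertex<c-mid : ∀ {s : Tree n} (u c : Vtx s) → u ≼ c → pt (sub u) <c mid c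
  vertex<c-mid u c u≼c with u ≟ᵥ c
  ... | yes refl = inj₁ (refl , z≤n) , λ ()
  ... | no u≢c   = inj₂ (u≼c , u≢c) , λ ()

  mid<c-vertex : ∀ {s : Tree n} {c w : Vtx s} → c ≺ w → mid c <c pt (sub w)
  mid<c-vertex c≺w = inj₂ c≺w , λ ()

  InnerCell : ∀ {s : Tree n} → Cell s → Set
  InnerCell (pt (sub v)) = IsInner v
  InnerCell _            = ⊥

  cellLabel : ∀ {s : Tree n} → Cell s → Maybe (Fin n)
  cellLabel (pt (sub v)) = labelVtx v
  cellLabel _            = nothing

  pt-sub-injective : ∀ {s : Tree n} {a b : Vtx s} → pt (sub a) ≡ pt (sub b) → a ≡ b
  pt-sub-injective refl = refl

  vert-injective : ∀ {t : Tree n} {x y : V t} → vert x ≡ vert y → x ≡ y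
  vert-injective refl = refl

  CellImage : ∀ {t s : Tree n} (f : V t → Cell s) → SCell t → Cell s → Set
  CellImage f (vert x) p = f x ≡ p
  CellImage f (edge v) p = f (sub v) <c p × p <c f (parent v)

  innerCell⇒vertex : ∀ {s : Tree n} (c : Cell s) → InnerCell c → ∃ λ w → c ≡ pt (sub w)
  innerCell⇒vertex (pt (sub v)) _  = v , refl
  innerCell⇒vertex (pt rootV)   ()
  innerCell⇒vertex (lo _)       ()
  innerCell⇒vertex (mid _)      ()
  innerCell⇒vertex (hi _)       ()

  labelledCell⇒vertex : ∀ {s : Tree n} (c : Cell s) {i} → cellLabel c ≡ just i →
                        ∃ λ w → c ≡ pt (sub w) × labelVtx w ≡ just i
  labelledCell⇒vertex (pt (sub v)) h  = v , refl , h
  labelledCell⇒vertex (pt rootV)   ()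
  labelledCell⇒vertex (lo _)       ()
  labelledCell⇒vertex (mid _)      ()
  labelledCell⇒vertex (hi _)       ()

  -- Embeddings of trees

  -- Label-preserving embeddings, edges going to paths: eL and eR descend into one child of the
  -- target, eNode and eSwap send root to root, matching the children in either order.
  data Emb : Tree n → Tree n → Set where
    eLeaf : ∀ {i} → Emb (leaf i) (leaf i)
    eL    : ∀ {t l r} → Emb t l → Emb t (node l r)
    eR    : ∀ {t l r} → Emb t r → Emb t (node l r)
    eNode : ∀ {l r l' r'} → Emb l l' → Emb r r' → Emb (node l r) (node l' r')
    eSwap : ∀ {l r l' r'} → Emb l r' → Emb r l' → Emb (node l r) (node l' r')

  emb : ∀ {t s} → Emb t s → Vtx t → Vtx s
  emb eLeaf       v       = v
  emb (eL e)      v       = inL (emb e v)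
  emb (eR e)      v       = inR (emb e v)
  emb (eNode a b) top     = top
  emb (eNode a b) (inL v) = inL (emb a v)
  emb (eNode a b) (inR v) = inR (emb b v)
  emb (eSwap a b) top     = top
  emb (eSwap a b) (inL v) = inR (emb a v)
  emb (eSwap a b) (inR v) = inL (emb b v)

  Emb-refl : (t : Tree n) → Emb t t
  Emb-refl (leaf i)   = eLeaf
  Emb-refl (node l r) = eNode (Emb-refl l) (Emb-refl r)

  emb-mono : ∀ {t s} (e : Emb t s) (v u : Vtx t) → v ≼ u → emb e v ≼ emb e u
  emb-mono eLeaf       v       u       p  = p
  emb-mono (eL e)      v       u       p  = emb-mono e v u p
  emb-mono (eR e)      v       u       p  = emb-mono e v u p
  emb-mono (eNode a b) v       top     p  = tt
  emb-mono (eNode a b) top     (inL u) ()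
  emb-mono (eNode a b) top     (inR u) ()
  emb-mono (eNode a b) (inL v) (inL u) p  = emb-mono a v u p
  emb-mono (eNode a b) (inR v) (inR u) p  = emb-mono b v u p
  emb-mono (eNode a b) (inL v) (inR u) ()
  emb-mono (eNode a b) (inR v) (inL u) ()
  emb-mono (eSwap a b) v       top     p  = tt
  emb-mono (eSwap a b) top     (inL u) ()
  emb-mono (eSwap a b) top     (inR u) ()
  emb-mono (eSwap a b) (inL v) (inL u) p  = emb-mono a v u p
  emb-mono (eSwap a b) (inR v) (inR u) p  = emb-mono b v u p
  emb-mono (eSwap a b) (inL v) (inR u) ()
  emb-mono (eSwap a b) (inR v) (inL u) ()

  emb-injective : ∀ {t s} (e : Emb t s) {v u : Vtx t} → emb e v ≡ emb e u → v ≡ u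
  emb-injective eLeaf       p = p
  emb-injective (eL e)      p = emb-injective e (inL-injective p)
  emb-injective (eR e)      p = emb-injective e (inR-injective p)
  emb-injective (eNode a b) {top}   {top}   p  = refl
  emb-injective (eNode a b) {inL v} {inL u} p  = cong inL (emb-injective a (inL-injective p))
  emb-injective (eNode a b) {inR v} {inR u} p  = cong inR (emb-injective b (inR-injective p))
  emb-injective (eNode a b) {top}   {inL u} ()
  emb-injective (eNode a b) {top}   {inR u} ()
  emb-injective (eNode a b) {inL v} {top}   ()
  emb-injective (eNode a b) {inR v} {top}   ()
  emb-injective (eNode a b) {inL v} {inR u} ()
  emb-injective (eNode a b) {inR v} {inL u} ()
  emb-injective (eSwap a b) {top}   {top}   p  = refl
  emb-injective (eSwap a b) {inL v} {inL u} p  = cong inL (emb-injective a (inR-injective p))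
  emb-injective (eSwap a b) {inR v} {inR u} p  = cong inR (emb-injective b (inL-injective p))
  emb-injective (eSwap a b) {top}   {inL u} ()
  emb-injective (eSwap a b) {top}   {inR u} ()
  emb-injective (eSwap a b) {inL v} {top}   ()
  emb-injective (eSwap a b) {inR v} {top}   ()
  emb-injective (eSwap a b) {inL v} {inR u} ()
  emb-injective (eSwap a b) {inR v} {inL u} ()

  emb-inner : ∀ {t s} (e : Emb t s) (v : Vtx t) → IsInner v → IsInner (emb e v)
  emb-inner eLeaf       v       h = h
  emb-inner (eL e)      v       h = emb-inner e v h
  emb-inner (eR e)      v       h = emb-inner e v h
  emb-inner (eNode a b) top     h = tt
  emb-inner (eNode a b) (inL v) h = emb-inner a v h
  emb-inner (eNode a b) (inR v) h = emb-inner b v h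
  emb-inner (eSwap a b) top     h = tt
  emb-inner (eSwap a b) (inL v) h = emb-inner a v h
  emb-inner (eSwap a b) (inR v) h = emb-inner b v h

  emb-label : ∀ {t s} (e : Emb t s) (v : Vtx t) → labelVtx (emb e v) ≡ labelVtx v
  emb-label eLeaf       v       = refl
  emb-label (eL e)      v       = emb-label e v
  emb-label (eR e)      v       = emb-label e v
  emb-label (eNode a b) top     = refl
  emb-label (eNode a b) (inL v) = emb-label a v
  emb-label (eNode a b) (inR v) = emb-label b v
  emb-label (eSwap a b) top     = refl
  emb-label (eSwap a b) (inL v) = emb-label a v
  emb-label (eSwap a b) (inR v) = emb-label b v

  emb-upperBound : ∀ {t s} (e : Emb t s) (a b : Vtx t) (k : Vtx s) → emb e a ≼ k → emb e b ≼ k →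
                   ∃ λ c → a ≼ c × b ≼ c × emb e c ≼ k
  emb-upperBound e           a       b       top     p  q  = top , tt , tt , tt
  emb-upperBound (eL e)      a       b       (inL k) p  q  = emb-upperBound e a b k p q
  emb-upperBound (eR e)      a       b       (inR k) p  q  = emb-upperBound e a b k p q
  emb-upperBound (eL e)      a       b       (inR k) () q
  emb-upperBound (eR e)      a       b       (inL k) () q
  emb-upperBound (eNode x y) top     b       (inL k) () q
  emb-upperBound (eNode x y) (inR a) b       (inL k) () q
  emb-upperBound (eNode x y) (inL a) top     (inL k) p  ()
  emb-upperBound (eNode x y) (inL a) (inR b) (inL k) p  ()
  emb-upperBound (eNode x y) (inL a) (inL b) (inL k) p  q
    with c , a≼c , b≼c , c≼k ← emb-upperBound x a b k p q = inL c , a≼c , b≼c , c≼k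
  emb-upperBound (eNode x y) top     b       (inR k) () q
  emb-upperBound (eNode x y) (inL a) b       (inR k) () q
  emb-upperBound (eNode x y) (inR a) top     (inR k) p  ()
  emb-upperBound (eNode x y) (inR a) (inL b) (inR k) p  ()
  emb-upperBound (eNode x y) (inR a) (inR b) (inR k) p  q
    with c , a≼c , b≼c , c≼k ← emb-upperBound y a b k p q = inR c , a≼c , b≼c , c≼k
  emb-upperBound (eSwap x y) top     b       (inL k) () q
  emb-upperBound (eSwap x y) (inL a) b       (inL k) () q
  emb-upperBound (eSwap x y) (inR a) top     (inL k) p  ()
  emb-upperBound (eSwap x y) (inR a) (inL b) (inL k) p  ()
  emb-upperBound (eSwap x y) (inR a) (inR b) (inL k) p  q
    with c , a≼c , b≼c , c≼k ← emb-upperBound y a b k p q = inR c , a≼c , b≼c , c≼k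
  emb-upperBound (eSwap x y) top     b       (inR k) () q
  emb-upperBound (eSwap x y) (inR a) b       (inR k) () q
  emb-upperBound (eSwap x y) (inL a) top     (inR k) p  ()
  emb-upperBound (eSwap x y) (inL a) (inR b) (inR k) p  ()
  emb-upperBound (eSwap x y) (inL a) (inL b) (inR k) p  q
    with c , a≼c , b≼c , c≼k ← emb-upperBound x a b k p q = inL c , a≼c , b≼c , c≼k

  emb-reflects-≼ : ∀ {t s} (e : Emb t s) (v u : Vtx t) → emb e v ≼ emb e u → v ≼ u
  emb-reflects-≼ e v u ev≼eu
    with c , v≼c , u≼c , ec≼eu ← emb-upperBound e v u (emb e u) ev≼eu (≼-refl (emb e u)) =
    subst (v ≼_) c≡u v≼c
    where
    c≡u : c ≡ u
    c≡u = emb-injective e (≼-antisym _ _ ec≼eu (emb-mono e u c u≼c))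

  leaves-emb : ∀ {t s : Tree n} → Emb t s → leaves t ⊆ leaves s
  leaves-emb eLeaf                        i∈t = i∈t
  leaves-emb (eL e)                       i∈t = ∈-++⁺ˡ (leaves-emb e i∈t)
  leaves-emb (eR {l = l} e)               i∈t = ∈-++⁺ʳ (leaves l) (leaves-emb e i∈t)
  leaves-emb (eNode {l = l} {l' = l'} a b) i∈t with ∈-++⁻ (leaves l) i∈t
  ... | inj₁ i∈l = ∈-++⁺ˡ (leaves-emb a i∈l)
  ... | inj₂ i∈r = ∈-++⁺ʳ (leaves l') (leaves-emb b i∈r)
  leaves-emb (eSwap {l = l} {l' = l'} a b) i∈t with ∈-++⁻ (leaves l) i∈t
  ... | inj₁ i∈l = ∈-++⁺ʳ (leaves l') (leaves-emb a i∈l)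
  ... | inj₂ i∈r = ∈-++⁺ˡ (leaves-emb b i∈r)

  leaves-nonEmpty : (t : Tree n) → NonEmpty (leaves t)
  leaves-nonEmpty (leaf i)   = i , here refl
  leaves-nonEmpty (node l r) with i , i∈l ← leaves-nonEmpty l = i , ∈-++⁺ˡ i∈l

  leaf-vertex : ∀ (t : Tree n) {i} → i ∈ leaves t → ∃ λ (v : Vtx t) → labelVtx v ≡ just i
  leaf-vertex (leaf j)   (here refl) = top , refl
  leaf-vertex (node l r) i∈t with ∈-++⁻ (leaves l) i∈t
  ... | inj₁ i∈l with v , v↦i ← leaf-vertex l i∈l = inL v , v↦i
  ... | inj₂ i∈r with v , v↦i ← leaf-vertex r i∈r = inR v , v↦i

  label⇒leaf : ∀ {t : Tree n} (v : Vtx t) {i} → labelVtx v ≡ just i → i ∈ leaves t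
  label⇒leaf {leaf j}   top     refl = here refl
  label⇒leaf {node l r} top     ()
  label⇒leaf {node l r} (inL v) eq   = ∈-++⁺ˡ (label⇒leaf v eq)
  label⇒leaf {node l r} (inR v) eq   = ∈-++⁺ʳ (leaves l) (label⇒leaf v eq)

  DistinctLeaves : Tree n → Set
  DistinctLeaves (leaf i)   = ⊤
  DistinctLeaves (node l r) = DistinctLeaves l × DistinctLeaves r × Disjoint (leaves l) (leaves r)

  distinct-emb : ∀ {t s : Tree n} → DistinctLeaves s → Emb t s → DistinctLeaves t
  distinct-emb d                  eLeaf       = tt
  distinct-emb (dl , _ , _)       (eL e)      = distinct-emb dl e
  distinct-emb (_ , dr , _)       (eR e)      = distinct-emb dr e
  distinct-emb (dl , dr , l#r)    (eNode a b) =
    distinct-emb dl a , distinct-emb dr b , λ (i∈l , i∈r) → l#r (leaves-emb a i∈l , leaves-emb b i∈r)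
  distinct-emb (dl , dr , l#r)    (eSwap a b) =
    distinct-emb dr a , distinct-emb dl b , λ (i∈l , i∈r) → l#r (leaves-emb b i∈r , leaves-emb a i∈l)

  meet-leaves : ∀ {t : Tree n} {x i j} → IsMeet t x i j → i ∈ leaves t × j ∈ leaves t
  meet-leaves (hereLR {l = l} i∈l j∈r) = ∈-++⁺ˡ i∈l , ∈-++⁺ʳ (leaves l) j∈r
  meet-leaves (hereRL {l = l} i∈r j∈l) = ∈-++⁺ʳ (leaves l) i∈r , ∈-++⁺ˡ j∈l
  meet-leaves (goL m) with i∈ , j∈ ← meet-leaves m = ∈-++⁺ˡ i∈ , ∈-++⁺ˡ j∈
  meet-leaves (goR {l = l} m) with i∈ , j∈ ← meet-leaves m = ∈-++⁺ʳ (leaves l) i∈ , ∈-++⁺ʳ (leaves l) j∈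

  meet-inner : ∀ {t : Tree n} {x i j} → IsMeet t x i j → IsInner x
  meet-inner (hereLR _ _) = tt
  meet-inner (hereRL _ _) = tt
  meet-inner (goL m)      = meet-inner m
  meet-inner (goR m)      = meet-inner m

  inner⇒meet : ∀ {t : Tree n} (x : Vtx t) → IsInner x → ∃ λ i → ∃ λ j → IsMeet t x i j
  inner⇒meet {node l r} top _ with i , i∈l ← leaves-nonEmpty l | j , j∈r ← leaves-nonEmpty r =
    i , j , hereLR i∈l j∈r
  inner⇒meet (inL x) h with i , j , m ← inner⇒meet x h = i , j , goL m
  inner⇒meet (inR x) h with i , j , m ← inner⇒meet x h = i , j , goR m

  meet-exists : ∀ (t : Tree n) {i j} → i ∈ leaves t → j ∈ leaves t → i ≢ j → ∃ λ x → IsMeet t x i j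
  meet-exists (leaf k) (here refl) (here refl) i≢j = ⊥-elim (i≢j refl)
  meet-exists (node l r) i∈t j∈t i≢j with ∈-++⁻ (leaves l) i∈t | ∈-++⁻ (leaves l) j∈t
  ... | inj₁ i∈l | inj₁ j∈l with x , m ← meet-exists l i∈l j∈l i≢j = inL x , goL m
  ... | inj₁ i∈l | inj₂ j∈r = top , hereLR i∈l j∈r
  ... | inj₂ i∈r | inj₁ j∈l = top , hereRL i∈r j∈l
  ... | inj₂ i∈r | inj₂ j∈r with x , m ← meet-exists r i∈r j∈r i≢j = inR x , goR m

  meet-distinct : ∀ {s : Tree n} → DistinctLeaves s → ∀ {x i j} → IsMeet s x i j → i ≢ j
  meet-distinct (_ , _ , l#r) (hereLR i∈l j∈r) refl = l#r (i∈l , j∈r)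
  meet-distinct (_ , _ , l#r) (hereRL i∈r j∈l) refl = l#r (j∈l , i∈r)
  meet-distinct (dl , _ , _)  (goL m)               = meet-distinct dl m
  meet-distinct (_ , dr , _)  (goR m)               = meet-distinct dr m

  meet-unique : ∀ {s : Tree n} → DistinctLeaves s → ∀ {x y i j} → IsMeet s x i j → IsMeet s y i j → x ≡ y
  meet-unique _              (hereLR _ _)     (hereLR _ _)     = refl
  meet-unique _              (hereRL _ _)     (hereRL _ _)     = refl
  meet-unique (_ , _ , l#r)  (hereLR i∈l _)   (hereRL i∈r _)   = ⊥-elim (l#r (i∈l , i∈r))
  meet-unique (_ , _ , l#r)  (hereRL i∈r _)   (hereLR i∈l _)   = ⊥-elim (l#r (i∈l , i∈r))
  meet-unique (_ , _ , l#r)  (hereLR _ j∈r)   (goL m)          = ⊥-elim (l#r (proj₂ (meet-leaves m) , j∈r))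
  meet-unique (_ , _ , l#r)  (hereLR i∈l _)   (goR m)          = ⊥-elim (l#r (i∈l , proj₁ (meet-leaves m)))
  meet-unique (_ , _ , l#r)  (hereRL i∈r _)   (goL m)          = ⊥-elim (l#r (proj₁ (meet-leaves m) , i∈r))
  meet-unique (_ , _ , l#r)  (hereRL _ j∈l)   (goR m)          = ⊥-elim (l#r (j∈l , proj₂ (meet-leaves m)))
  meet-unique (_ , _ , l#r)  (goL m)          (hereLR _ j∈r)   = ⊥-elim (l#r (proj₂ (meet-leaves m) , j∈r))
  meet-unique (_ , _ , l#r)  (goR m)          (hereLR i∈l _)   = ⊥-elim (l#r (i∈l , proj₁ (meet-leaves m)))
  meet-unique (_ , _ , l#r)  (goL m)          (hereRL i∈r _)   = ⊥-elim (l#r (proj₁ (meet-leaves m) , i∈r))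
  meet-unique (_ , _ , l#r)  (goR m)          (hereRL _ j∈l)   = ⊥-elim (l#r (j∈l , proj₂ (meet-leaves m)))
  meet-unique (dl , _ , _)   (goL m)          (goL m')         = cong inL (meet-unique dl m m')
  meet-unique (_ , dr , _)   (goR m)          (goR m')         = cong inR (meet-unique dr m m')
  meet-unique (_ , _ , l#r)  (goL m)          (goR m')         =
    ⊥-elim (l#r (proj₁ (meet-leaves m) , proj₁ (meet-leaves m')))
  meet-unique (_ , _ , l#r)  (goR m)          (goL m')         =
    ⊥-elim (l#r (proj₁ (meet-leaves m') , proj₁ (meet-leaves m)))

  emb-meet : ∀ {t s : Tree n} (e : Emb t s) {x i j} → IsMeet t x i j → IsMeet s (emb e x) i j
  emb-meet (eL e)      m                = goL (emb-meet e m)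
  emb-meet (eR e)      m                = goR (emb-meet e m)
  emb-meet (eNode a b) (hereLR i∈l j∈r) = hereLR (leaves-emb a i∈l) (leaves-emb b j∈r)
  emb-meet (eNode a b) (hereRL i∈r j∈l) = hereRL (leaves-emb b i∈r) (leaves-emb a j∈l)
  emb-meet (eNode a b) (goL m)          = goL (emb-meet a m)
  emb-meet (eNode a b) (goR m)          = goR (emb-meet b m)
  emb-meet (eSwap a b) (hereLR i∈l j∈r) = hereRL (leaves-emb a i∈l) (leaves-emb b j∈r)
  emb-meet (eSwap a b) (hereRL i∈r j∈l) = hereLR (leaves-emb b i∈r) (leaves-emb a j∈l)
  emb-meet (eSwap a b) (goL m)          = goR (emb-meet a m)
  emb-meet (eSwap a b) (goR m)          = goL (emb-meet b m)

  unique⇒distinct : ∀ (t : Tree n) → Unique (leaves t) → DistinctLeaves t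
  unique⇒distinct (leaf i)   _ = tt
  unique⇒distinct (node l r) u with u-l , u-r , l#r ← Unique-++⁻ (leaves l) u =
    unique⇒distinct l u-l , unique⇒distinct r u-r , l#r

  distinct⇒unique : ∀ (t : Tree n) → DistinctLeaves t → Unique (leaves t)
  distinct⇒unique (leaf i)   _               = [] ∷ []
  distinct⇒unique (node l r) (dl , dr , l#r) = Uniqueₚ.++⁺ (distinct⇒unique l dl) (distinct⇒unique r dr) l#r

  ↭allFin⇒unique : ∀ {xs : List (Fin n)} → xs ↭ allFin n → Unique xs
  ↭allFin⇒unique xs↭I = Unique-resp-↭ (↭⇒↭ₛ (↭-sym xs↭I)) (Uniqueₚ.allFin⁺ n)

  isTreeOn⇒distinct : ∀ {T : Tree n} → IsTreeOn T → DistinctLeaves T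
  isTreeOn⇒distinct {T} isT = unique⇒distinct T (↭allFin⇒unique isT)

  ⊆-++-disjointʳ : ∀ {A B C : List (Fin n)} → A ⊆ (B ++ C) → Disjoint A C → A ⊆ B
  ⊆-++-disjointʳ {B = B} A⊆BC A#C i∈A with ∈-++⁻ B (A⊆BC i∈A)
  ... | inj₁ i∈B = i∈B
  ... | inj₂ i∈C = ⊥-elim (A#C (i∈A , i∈C))

  ⊆-++-disjointˡ : ∀ {A B C : List (Fin n)} → A ⊆ (B ++ C) → Disjoint A B → A ⊆ C
  ⊆-++-disjointˡ {B = B} A⊆BC A#B i∈A with ∈-++⁻ B (A⊆BC i∈A)
  ... | inj₁ i∈B = ⊥-elim (A#B (i∈A , i∈B))
  ... | inj₂ i∈C = i∈C

  emb-⊆-disjoint : ∀ {t u X Y : Tree n} → Emb t X → Emb u Y → leaves t ⊆ leaves u →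
                   ¬ Disjoint (leaves X) (leaves Y)
  emb-⊆-disjoint {t} et eu t⊆u X#Y with i , i∈t ← leaves-nonEmpty t =
    X#Y (leaves-emb et i∈t , leaves-emb eu (t⊆u i∈t))

  Factors : ∀ {t u s : Tree n} → Emb t s → Emb u s → Set
  Factors {t} {u} et eu = Σ (Emb t u) λ c → ∀ v → emb eu (emb c v) ≡ emb et v

  factor : ∀ {s t u : Tree n} → DistinctLeaves s → (et : Emb t s) (eu : Emb u s) → leaves t ⊆ leaves u →
           Factors et eu
  factor _ eLeaf eLeaf _ = eLeaf , λ { top → refl }
  factor (dl , _ , _) (eL et) (eL eu) t⊆u with c , h ← factor dl et eu t⊆u = c , λ v → cong inL (h v)
  factor (_ , dr , _) (eR et) (eR eu) t⊆u with c , h ← factor dr et eu t⊆u = c , λ v → cong inR (h v)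
  factor (_ , _ , l#r) (eL et) (eR eu) t⊆u = ⊥-elim (emb-⊆-disjoint et eu t⊆u l#r)
  factor (_ , _ , l#r) (eR et) (eL eu) t⊆u = ⊥-elim (emb-⊆-disjoint et eu t⊆u (Disjoint-sym l#r))
  factor {t = node t₁ t₂} (_ , _ , l#r) (eNode et₁ et₂) (eL eu) t⊆u =
    ⊥-elim (emb-⊆-disjoint et₂ eu (t⊆u ∘ ∈-++⁺ʳ (leaves t₁)) (Disjoint-sym l#r))
  factor (_ , _ , l#r) (eNode et₁ et₂) (eR eu) t⊆u = ⊥-elim (emb-⊆-disjoint et₁ eu (t⊆u ∘ ∈-++⁺ˡ) l#r)
  factor (_ , _ , l#r) (eSwap et₁ et₂) (eL eu) t⊆u =
    ⊥-elim (emb-⊆-disjoint et₁ eu (t⊆u ∘ ∈-++⁺ˡ) (Disjoint-sym l#r))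
  factor {t = node t₁ t₂} (_ , _ , l#r) (eSwap et₁ et₂) (eR eu) t⊆u =
    ⊥-elim (emb-⊆-disjoint et₂ eu (t⊆u ∘ ∈-++⁺ʳ (leaves t₁)) l#r)
  factor (dl , _ , l#r) (eL et) (eNode eu₁ eu₂) t⊆u
    with c , h ← factor dl et eu₁ (⊆-++-disjointʳ t⊆u
                   λ (i∈t , i∈u₂) → l#r (leaves-emb et i∈t , leaves-emb eu₂ i∈u₂)) =
    eL c , λ v → cong inL (h v)
  factor (dl , _ , l#r) (eL et) (eSwap eu₁ eu₂) t⊆u
    with c , h ← factor dl et eu₂ (⊆-++-disjointˡ t⊆u
                   λ (i∈t , i∈u₁) → l#r (leaves-emb et i∈t , leaves-emb eu₁ i∈u₁)) =
    eR c , λ v → cong inL (h v)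
  factor (_ , dr , l#r) (eR et) (eNode eu₁ eu₂) t⊆u
    with c , h ← factor dr et eu₂ (⊆-++-disjointˡ t⊆u
                   λ (i∈t , i∈u₁) → l#r (leaves-emb eu₁ i∈u₁ , leaves-emb et i∈t)) =
    eR c , λ v → cong inR (h v)
  factor (_ , dr , l#r) (eR et) (eSwap eu₁ eu₂) t⊆u
    with c , h ← factor dr et eu₁ (⊆-++-disjointʳ t⊆u
                   λ (i∈t , i∈u₂) → l#r (leaves-emb eu₂ i∈u₂ , leaves-emb et i∈t)) =
    eL c , λ v → cong inR (h v)
  factor {t = node t₁ t₂} (dl , dr , l#r) (eNode et₁ et₂) (eNode eu₁ eu₂) t⊆u
    with c₁ , h₁ ← factor dl et₁ eu₁ (⊆-++-disjointʳ (t⊆u ∘ ∈-++⁺ˡ)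
                     λ (i∈t₁ , i∈u₂) → l#r (leaves-emb et₁ i∈t₁ , leaves-emb eu₂ i∈u₂))
       | c₂ , h₂ ← factor dr et₂ eu₂ (⊆-++-disjointˡ (t⊆u ∘ ∈-++⁺ʳ (leaves t₁))
                     λ (i∈t₂ , i∈u₁) → l#r (leaves-emb eu₁ i∈u₁ , leaves-emb et₂ i∈t₂)) =
    eNode c₁ c₂ , λ { top → refl ; (inL v) → cong inL (h₁ v) ; (inR v) → cong inR (h₂ v) }
  factor {t = node t₁ t₂} (dl , dr , l#r) (eNode et₁ et₂) (eSwap eu₁ eu₂) t⊆u
    with c₁ , h₁ ← factor dl et₁ eu₂ (⊆-++-disjointˡ (t⊆u ∘ ∈-++⁺ˡ)
                     λ (i∈t₁ , i∈u₁) → l#r (leaves-emb et₁ i∈t₁ , leaves-emb eu₁ i∈u₁))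
       | c₂ , h₂ ← factor dr et₂ eu₁ (⊆-++-disjointʳ (t⊆u ∘ ∈-++⁺ʳ (leaves t₁))
                     λ (i∈t₂ , i∈u₂) → l#r (leaves-emb eu₂ i∈u₂ , leaves-emb et₂ i∈t₂)) =
    eSwap c₁ c₂ , λ { top → refl ; (inL v) → cong inL (h₁ v) ; (inR v) → cong inR (h₂ v) }
  factor {t = node t₁ t₂} (dl , dr , l#r) (eSwap et₁ et₂) (eNode eu₁ eu₂) t⊆u
    with c₁ , h₁ ← factor dr et₁ eu₂ (⊆-++-disjointˡ (t⊆u ∘ ∈-++⁺ˡ)
                     λ (i∈t₁ , i∈u₁) → l#r (leaves-emb eu₁ i∈u₁ , leaves-emb et₁ i∈t₁))
       | c₂ , h₂ ← factor dl et₂ eu₁ (⊆-++-disjointʳ (t⊆u ∘ ∈-++⁺ʳ (leaves t₁))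
                     λ (i∈t₂ , i∈u₂) → l#r (leaves-emb et₂ i∈t₂ , leaves-emb eu₂ i∈u₂)) =
    eSwap c₁ c₂ , λ { top → refl ; (inL v) → cong inR (h₁ v) ; (inR v) → cong inL (h₂ v) }
  factor {t = node t₁ t₂} (dl , dr , l#r) (eSwap et₁ et₂) (eSwap eu₁ eu₂) t⊆u
    with c₁ , h₁ ← factor dr et₁ eu₁ (⊆-++-disjointʳ (t⊆u ∘ ∈-++⁺ˡ)
                     λ (i∈t₁ , i∈u₂) → l#r (leaves-emb eu₂ i∈u₂ , leaves-emb et₁ i∈t₁))
       | c₂ , h₂ ← factor dl et₂ eu₂ (⊆-++-disjointˡ (t⊆u ∘ ∈-++⁺ʳ (leaves t₁))
                     λ (i∈t₂ , i∈u₁) → l#r (leaves-emb et₂ i∈t₂ , leaves-emb eu₁ i∈u₁)) =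
    eNode c₁ c₂ , λ { top → refl ; (inL v) → cong inR (h₁ v) ; (inR v) → cong inL (h₂ v) }

  -- Restricting a tree to a set of labels

  ∈-node-elim : ∀ (l r : Tree n) {i} {P : Set} →
                (i ∈ leaves l → P) → (i ∈ leaves r → P) → i ∈ leaves (node l r) → P
  ∈-node-elim l r f g i∈t = [ f , g ]′ (∈-++⁻ (leaves l) i∈t)

  data Restriction (t : Tree n) (B : List (Fin n)) : Set where
    none : Disjoint (leaves t) B → Restriction t B
    some : (u : Tree n) → Emb u t → leaves u ⊆ B → (∀ {i} → i ∈ leaves t → i ∈ B → i ∈ leaves u) →
           Restriction t B

  restrict : (t : Tree n) (B : List (Fin n)) → Restriction t B
  restrict (leaf i) B with i ∈? B
  ... | yes i∈B = some (leaf i) eLeaf (λ { (here refl) → i∈B }) (λ { (here refl) _ → here refl })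
  ... | no  i∉B = none λ { (here refl , i∈B) → i∉B i∈B }
  restrict (node l r) B with restrict l B | restrict r B
  ... | none l#B | none r#B =
    none λ (i∈t , i∈B) → ∈-node-elim l r (λ i∈l → l#B (i∈l , i∈B)) (λ i∈r → r#B (i∈r , i∈B)) i∈t
  ... | some ul el ul⊆B l∩B⊆ul | none r#B =
    some ul (eL el) ul⊆B λ i∈t i∈B →
      ∈-node-elim l r (λ i∈l → l∩B⊆ul i∈l i∈B) (λ i∈r → ⊥-elim (r#B (i∈r , i∈B))) i∈t
  ... | none l#B | some ur er ur⊆B r∩B⊆ur =
    some ur (eR er) ur⊆B λ i∈t i∈B →
      ∈-node-elim l r (λ i∈l → ⊥-elim (l#B (i∈l , i∈B))) (λ i∈r → r∩B⊆ur i∈r i∈B) i∈t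
  ... | some ul el ul⊆B l∩B⊆ul | some ur er ur⊆B r∩B⊆ur =
    some (node ul ur) (eNode el er) (∈-node-elim ul ur ul⊆B ur⊆B) λ i∈t i∈B →
      ∈-node-elim l r (λ i∈l → ∈-++⁺ˡ (l∩B⊆ul i∈l i∈B)) (λ i∈r → ∈-++⁺ʳ (leaves ul) (r∩B⊆ur i∈r i∈B)) i∈t

  module _ (t : Tree n) (B : List (Fin n)) where

    -- When B misses t the value is junk; it is only used for nonempty B ⊆ leaves t.
    restrictedTree : Tree n
    restrictedTree with restrict t B
    ... | none _         = t
    ... | some u _ _ _   = u

    restricted-emb : Emb restrictedTree t
    restricted-emb with restrict t B
    ... | none _         = Emb-refl t
    ... | some _ e _ _   = e

    restricted-⊆ : NonEmpty B → B ⊆ leaves t → leaves restrictedTree ⊆ B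
    restricted-⊆ (i , i∈B) B⊆t with restrict t B
    ... | none t#B       = ⊥-elim (t#B (B⊆t i∈B , i∈B))
    ... | some _ _ u⊆B _ = u⊆B

    restricted-⊇ : B ⊆ leaves t → B ⊆ leaves restrictedTree
    restricted-⊇ B⊆t i∈B with restrict t B
    ... | none t#B        = ⊥-elim (t#B (B⊆t i∈B , i∈B))
    ... | some _ _ _ t∩B⊆ = t∩B⊆ (B⊆t i∈B) i∈B

  -- Embeddings and maps satisfying (D1)–(D4)

  record IsTreeMap {t s : Tree n} (f : V t → Cell s) : Set where
    field
      increasing : ∀ v → f (sub v) ≤c f (parent v)
      inner      : ∀ v → IsInner v → InnerCell (f (sub v))
      labelled   : ∀ v i → labelVtx v ≡ just i → cellLabel (f (sub v)) ≡ just i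
      injective  : ∀ x y p → CellImage f x p → CellImage f y p → x ≡ y

  embCell : ∀ {t s} → Emb t s → V t → Cell s
  embCell e rootV   = pt rootV
  embCell e (sub v) = pt (sub (emb e v))

  module _ {t s : Tree n} (e : Emb t s) where

    embCell-increasing : ∀ v → embCell e (sub v) ≤c embCell e (parent v)
    embCell-increasing v with parent v in eq
    ... | rootV = tt
    ... | sub w with v≼w , v≢w ← parent-≻ v eq =
      inj₂ (emb-mono e v w v≼w , λ ev≡ew → v≢w (emb-injective e ev≡ew))

    -- The edge from z ends at the image of its parent, which is weakly below the image of any c ≻ z.
    ancestor-below-edge⇒≡ : ∀ z c (p : Cell s) {k} → z ≼ c → cellVtx p ≡ just k →
                             emb e c ≼ k → p <c embCell e (parent z) → z ≡ c
    ancestor-below-edge⇒≡ z c p {k} z≼c p↦k ec≼k p<parent with z ≟ᵥ c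
    ... | yes z≡c = z≡c
    ... | no z≢c with w , parent≡w , w≼c ← ≺⇒parent-≼ z c (z≼c , z≢c) =
      ⊥-elim (k≢ew (≼-antisym _ _ k≼ew (≼-trans (emb e w) (emb e c) k (emb-mono e w c w≼c) ec≼k)))
      where
      k≺ew = <c-vertex⇒≺ p (subst (λ x → p <c embCell e x) parent≡w p<parent) p↦k
      k≼ew = proj₁ k≺ew
      k≢ew = proj₂ k≺ew

    vertex-edge-disjoint : ∀ x v p → CellImage (embCell e) (vert x) p → ¬ CellImage (embCell e) (edge v) p
    vertex-edge-disjoint rootV   v p refl (_ , p<parent) = root-maximal _ p<parent
    vertex-edge-disjoint (sub u) v p refl (v<u , u<parent) =
      proj₂ ev≺eu (cong (emb e) (ancestor-below-edge⇒≡ v u p v≼u refl (≼-refl (emb e u)) u<parent))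
      where
      ev≺eu = <c-vertex⇒≺ (pt (sub (emb e v))) v<u refl
      v≼u = emb-reflects-≼ e v u (proj₁ ev≺eu)

    edge-edge-disjoint : ∀ v v' p → CellImage (embCell e) (edge v) p → CellImage (embCell e) (edge v') p →
                         v ≡ v'
    edge-edge-disjoint v v' p (v<p , p<parent) (v'<p , p<parent')
      with k , p↦k ← <c⇒cellVtx p p<parent
      with c , v≼c , v'≼c , ec≼k ← emb-upperBound e v v' k (vertex≤c⇒≼ p (proj₁ v<p) p↦k)
                                                           (vertex≤c⇒≼ p (proj₁ v'<p) p↦k) =
      trans (ancestor-below-edge⇒≡ v c p v≼c p↦k ec≼k p<parent)
            (sym (ancestor-below-edge⇒≡ v' c p v'≼c p↦k ec≼k p<parent'))

    embCell-injective : ∀ x y p → CellImage (embCell e) x p → CellImage (embCell e) y p → x ≡ y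
    embCell-injective (vert rootV)   (vert rootV)    p _    _    = refl
    embCell-injective (vert rootV)   (vert (sub u))  p refl ()
    embCell-injective (vert (sub u)) (vert rootV)    p refl ()
    embCell-injective (vert (sub u)) (vert (sub u')) p refl i₂   =
      cong (λ w → vert (sub w)) (emb-injective e (pt-sub-injective (sym i₂)))
    embCell-injective (vert x)       (edge v)        p i₁   i₂   = ⊥-elim (vertex-edge-disjoint x v p i₁ i₂)
    embCell-injective (edge v)       (vert x)        p i₁   i₂   = ⊥-elim (vertex-edge-disjoint x v p i₂ i₁)
    embCell-injective (edge v)       (edge v')       p i₁   i₂   = cong edge (edge-edge-disjoint v v' p i₁ i₂)

  labelled⇒leafEmb : ∀ {s : Tree n} {i} (w : Vtx s) → labelVtx w ≡ just i →
                     Σ (Emb (leaf i) s) λ e → emb e top ≡ w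
  labelled⇒leafEmb {leaf j}   top     refl = eLeaf , refl
  labelled⇒leafEmb {node l r} top     ()
  labelled⇒leafEmb            (inL w) eq with e , e↦w ← labelled⇒leafEmb w eq = eL e , cong inL e↦w
  labelled⇒leafEmb            (inR w) eq with e , e↦w ← labelled⇒leafEmb w eq = eR e , cong inR e↦w

  Grafted : ∀ {l r s : Tree n} → Vtx s → Emb l s → Emb r s → Set
  Grafted {l} {r} {s} w a b = Σ (Emb (node l r) s) λ j →
    emb j top ≡ w × (∀ v → emb j (inL v) ≡ emb a v) × (∀ v → emb j (inR v) ≡ emb b v)

  graft : ∀ {l r s : Tree n} (w : Vtx s) (a : Emb l s) (b : Emb r s) → emb a top ≺ w → emb b top ≺ w →
          (∀ c → emb a top ≼ c → emb b top ≼ c → ¬ c ≺ w) → Grafted w a b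
  graft w       eLeaf       b           a≺w _   _  = ⊥-elim (¬top≺ w a≺w)
  graft w       (eNode _ _) b           a≺w _   _  = ⊥-elim (¬top≺ w a≺w)
  graft w       (eSwap _ _) b           a≺w _   _  = ⊥-elim (¬top≺ w a≺w)
  graft w       a           (eNode _ _) _   b≺w _  = ⊥-elim (¬top≺ w b≺w)
  graft w       a           (eSwap _ _) _   b≺w _  = ⊥-elim (¬top≺ w b≺w)
  graft top     (eL a)      (eR b)      _   _   _  = eNode a b , refl , (λ _ → refl) , (λ _ → refl)
  graft top     (eR a)      (eL b)      _   _   _  = eSwap a b , refl , (λ _ → refl) , (λ _ → refl)
  graft top     (eL a)      (eL b)      _   _   nc = ⊥-elim (nc (inL top) tt tt (tt , λ ()))
  graft top     (eR a)      (eR b)      _   _   nc = ⊥-elim (nc (inR top) tt tt (tt , λ ()))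
  graft (inL w) (eL a)      (eL b)      a≺w b≺w nc
    with j , jtop , jL , jR ← graft w a b (inL-≺⁻ a≺w) (inL-≺⁻ b≺w)
                                       (λ c p q c≺w → nc (inL c) p q (inL-≺ c≺w)) =
    eL j , cong inL jtop , (λ v → cong inL (jL v)) , (λ v → cong inL (jR v))
  graft (inR w) (eR a)      (eR b)      a≺w b≺w nc
    with j , jtop , jL , jR ← graft w a b (inR-≺⁻ a≺w) (inR-≺⁻ b≺w)
                                       (λ c p q c≺w → nc (inR c) p q (inR-≺ c≺w)) =
    eR j , cong inR jtop , (λ v → cong inR (jL v)) , (λ v → cong inR (jR v))
  graft (inL w) (eR a)      _           (() , _) _ _
  graft (inR w) (eL a)      _           (() , _) _ _
  graft (inL w) (eL a)      (eR b)      _ (() , _) _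
  graft (inR w) (eR a)      (eL b)      _ (() , _) _

  liftCellL : ∀ {l r : Tree n} → SCell l → SCell (node l r)
  liftCellL (vert x) = vert (liftL x)
  liftCellL (edge v) = edge (inL v)

  liftCellR : ∀ {l r : Tree n} → SCell r → SCell (node l r)
  liftCellR (vert x) = vert (liftR x)
  liftCellR (edge v) = edge (inR v)

  liftCellL-injective : ∀ {l r : Tree n} (x y : SCell l) → liftCellL {r = r} x ≡ liftCellL y → x ≡ y
  liftCellL-injective (vert x) (vert y) eq   = cong vert (liftL-injective (vert-injective eq))
  liftCellL-injective (edge u) (edge v) refl = refl
  liftCellL-injective (vert x) (edge v) ()
  liftCellL-injective (edge u) (vert y) ()

  liftCellR-injective : ∀ {l r : Tree n} (x y : SCell r) → liftCellR {l = l} x ≡ liftCellR y → x ≡ y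
  liftCellR-injective (vert x) (vert y) eq   = cong vert (liftR-injective (vert-injective eq))
  liftCellR-injective (edge u) (edge v) refl = refl
  liftCellR-injective (vert x) (edge v) ()
  liftCellR-injective (edge u) (vert y) ()

  module _ {l r s : Tree n} {f : V (node l r) → Cell s} (m : IsTreeMap f) where
    open IsTreeMap m

    isTreeMap-left : IsTreeMap (f ∘ liftL)
    isTreeMap-left = record
      { increasing = λ v → subst (λ x → f (sub (inL v)) ≤c f x) (parent-inL v) (increasing (inL v))
      ; inner      = λ v → inner (inL v)
      ; labelled   = λ v → labelled (inL v)
      ; injective  = λ x y p i₁ i₂ → liftCellL-injective x y (injective _ _ p (image x p i₁) (image y p i₂))
      }
      where
      image : ∀ x p → CellImage (f ∘ liftL) x p → CellImage f (liftCellL x) p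
      image (vert x) p i                 = i
      image (edge v) p (v<p , p<parent) = v<p , subst (λ x → p <c f x) (sym (parent-inL v)) p<parent

    isTreeMap-right : IsTreeMap (f ∘ liftR)
    isTreeMap-right = record
      { increasing = λ v → subst (λ x → f (sub (inR v)) ≤c f x) (parent-inR v) (increasing (inR v))
      ; inner      = λ v → inner (inR v)
      ; labelled   = λ v → labelled (inR v)
      ; injective  = λ x y p i₁ i₂ → liftCellR-injective x y (injective _ _ p (image x p i₁) (image y p i₂))
      }
      where
      image : ∀ x p → CellImage (f ∘ liftR) x p → CellImage f (liftCellR x) p
      image (vert x) p i                 = i
      image (edge v) p (v<p , p<parent) = v<p , subst (λ x → p <c f x) (sym (parent-inR v)) p<parent

  InducedBy : ∀ {t s : Tree n} → (V t → Cell s) → Emb t s → Set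
  InducedBy f e = ∀ v → f (sub v) ≡ embCell e (sub v)

  module _ {t s : Tree n} {f : V t → Cell s} (m : IsTreeMap f) where
    open IsTreeMap m

    isTreeMap-vertex-injective : ∀ {u v} → f (sub u) ≡ f (sub v) → u ≡ v
    isTreeMap-vertex-injective {u} {v} eq with injective (vert (sub u)) (vert (sub v)) (f (sub v)) eq refl
    ... | refl = refl

  module _ {l r s : Tree n} {f : V (node l r) → Cell s} (m : IsTreeMap f) {w : Vtx s}
           (f-top : f (sub top) ≡ pt (sub w)) where
    open IsTreeMap m

    left-child≺ : ∀ {a : Emb l s} → InducedBy (f ∘ liftL) a → emb a top ≺ w
    left-child≺ {a} fa =
      vertex≤c⇒≼ (pt (sub w)) (subst₂ _≤c_ (fa top) f-top (increasing (inL top))) refl , a≢w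
      where
      a≢w : emb a top ≢ w
      a≢w refl with () ← isTreeMap-vertex-injective m (trans (fa top) (sym f-top))

    right-child≺ : ∀ {b : Emb r s} → InducedBy (f ∘ liftR) b → emb b top ≺ w
    right-child≺ {b} fb =
      vertex≤c⇒≼ (pt (sub w)) (subst₂ _≤c_ (fb top) f-top (increasing (inR top))) refl , b≢w
      where
      b≢w : emb b top ≢ w
      b≢w refl with () ← isTreeMap-vertex-injective m (trans (fb top) (sym f-top))

    -- Otherwise both edges leaving the root's children would pass through the midpoint of c's edge.
    children-apart : ∀ {a : Emb l s} {b : Emb r s} → InducedBy (f ∘ liftL) a → InducedBy (f ∘ liftR) b →
                     ∀ c → emb a top ≼ c → emb b top ≼ c → ¬ c ≺ w
    children-apart {a} {b} fa fb c a≼c b≼c c≺w =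
      edges-differ (injective (edge (inL top)) (edge (inR top)) (mid c)
        (subst (_<c mid c) (sym (fa top)) (vertex<c-mid (emb a top) c a≼c) , mid<w)
        (subst (_<c mid c) (sym (fb top)) (vertex<c-mid (emb b top) c b≼c) , mid<w))
      where
      mid<w : mid c <c f (sub top)
      mid<w = subst (mid c <c_) (sym f-top) (mid<c-vertex c≺w)
      edges-differ : edge (inL top) ≢ edge (inR top)
      edges-differ ()

  isTreeMap-node : ∀ {l r s : Tree n} {f : V (node l r) → Cell s} → IsTreeMap f →
                   (a : Emb l s) → InducedBy (f ∘ liftL) a → (b : Emb r s) → InducedBy (f ∘ liftR) b →
                   Σ (Emb (node l r) s) (InducedBy f)
  isTreeMap-node {f = f} m a fa b fb
    with w , f-top ← innerCell⇒vertex (f (sub top)) (IsTreeMap.inner m top tt)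
    with j , jtop , jL , jR ← graft w a b (left-child≺ m f-top fa) (right-child≺ m f-top fb)
                                       (children-apart m f-top fa fb) =
    j , λ { top     → trans f-top (cong (λ x → pt (sub x)) (sym jtop))
          ; (inL v) → trans (fa v) (cong (λ x → pt (sub x)) (sym (jL v)))
          ; (inR v) → trans (fb v) (cong (λ x → pt (sub x)) (sym (jR v))) }

  isTreeMap⇒emb : ∀ {s : Tree n} (t : Tree n) {f : V t → Cell s} → IsTreeMap f → Σ (Emb t s) (InducedBy f)
  isTreeMap⇒emb (leaf i) {f} m
    with w , f-top , w↦i ← labelledCell⇒vertex (f (sub top)) (IsTreeMap.labelled m top i refl)
    with e , e↦w ← labelled⇒leafEmb w w↦i =
    e , λ { top → trans f-top (cong (λ x → pt (sub x)) (sym e↦w)) }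
  isTreeMap⇒emb (node l r) m with a , fa ← isTreeMap⇒emb l (isTreeMap-left m)
                                 | b , fb ← isTreeMap⇒emb r (isTreeMap-right m) =
    isTreeMap-node m a fa b fb

  <c⇒PLt : ∀ {G : Forest {n}} {k} {c d : Cell (lookup G k)} → c <c d → PLt G (k , c) (k , d)
  <c⇒PLt (c≤d , c≢d) = same c≤d , λ eq → c≢d (,-injectiveʳ eq)

  image-within-tree : ∀ {F G : Forest {n}} (B : Fin (length F) → Fin (length G))
                      (f : ∀ a → V (lookup F a) → Cell (lookup G (B a))) a x (p : Point G) →
                      Img F G (λ a x → B a , f a x) a x p → ∃ λ c → p ≡ (B a , c) × CellImage (f a) x c
  image-within-tree B f a (vert x) p refl = f a x , refl , refl
  image-within-tree B f a (edge v) (k , c) ((same v≤c , v≢c) , (same c≤parent , c≢parent)) =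
    c , refl , (v≤c , λ eq → v≢c (cong (B a ,_) eq)) , (c≤parent , λ eq → c≢parent (cong (B a ,_) eq))

  record ForestEmbedding (F G : Forest {n}) : Set where
    field
      tree      : Fin (length F) → Fin (length G)
      embedding : ∀ a → Emb (lookup F a) (lookup G (tree a))
      inner-injective : ∀ a b (v : Vtx (lookup F a)) (w : Vtx (lookup F b)) → IsInner v → IsInner w →
                        _≡_ {A = Point G} (tree a , pt (sub (emb (embedding a) v)))
                                          (tree b , pt (sub (emb (embedding b) w))) →
                        _≡_ {A = Σ (Fin (length F)) (λ c → Vtx (lookup F c))} (a , v) (b , w)

  fromEmbeddings : ∀ {F G : Forest {n}} → ForestEmbedding F G → F ≤F G
  fromEmbeddings {F} {G} E = record
    { φ      = φ
    ; φ-pt   = λ { a rootV → tt ; a (sub v) → tt }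
    ; D1     = λ a v → same (embCell-increasing (embedding a) v)
    ; D2-in  = λ a → emb-inner (embedding a)
    ; D2-inj = inner-injective
    ; D3     = λ a v i eq → trans (emb-label (embedding a) v) eq
    ; D4     = D4
    }
    where
    open ForestEmbedding E
    φ : (a : Fin (length F)) → V (lookup F a) → Point G
    φ a x = tree a , embCell (embedding a) x
    D4 : ∀ a (x y : SCell (lookup F a)) (p : Point G) → Img F G φ a x p → Img F G φ a y p → x ≡ y
    D4 a x y p i₁ i₂
      with c , refl , j₁ ← image-within-tree tree (λ a → embCell (embedding a)) a x p i₁
      with _ , refl , j₂ ← image-within-tree tree (λ a → embCell (embedding a)) a y p i₂ =
      embCell-injective (embedding a) x y c j₁ j₂

  module _ {T : Tree n} where

    cellOf : Point (T ∷ []) → Cell T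
    cellOf (fz , c) = c

    point-η : (p : Point (T ∷ [])) → p ≡ (fz , cellOf p)
    point-η (fz , c) = refl

    PLe⇒≤c : (p q : Point (T ∷ [])) → PLe (T ∷ []) p q → cellOf p ≤c cellOf q
    PLe⇒≤c (fz , c) (fz , d) (same c≤d) = c≤d

    innerPt⇒innerCell : (p : Point (T ∷ [])) → InnerPt (T ∷ []) p → InnerCell (cellOf p)
    innerPt⇒innerCell (fz , pt (sub v)) h = h

    ptLabel⇒cellLabel : (p : Point (T ∷ [])) {i : Fin n} → ptLabel (T ∷ []) p ≡ just i →
                        cellLabel (cellOf p) ≡ just i
    ptLabel⇒cellLabel (fz , pt (sub v)) h  = h
    ptLabel⇒cellLabel (fz , pt rootV)   ()
    ptLabel⇒cellLabel (fz , lo _)       ()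
    ptLabel⇒cellLabel (fz , mid _)      ()
    ptLabel⇒cellLabel (fz , hi _)       ()

    module _ {F : Forest {n}} (F≤T : F ≤F (T ∷ [])) (a : Fin (length F)) where
      open _≤F_ F≤T

      ≤F-isTreeMap : IsTreeMap (cellOf ∘ φ a)
      ≤F-isTreeMap = record
        { increasing = λ v → PLe⇒≤c (φ a (sub v)) (φ a (parent v)) (D1 a v)
        ; inner      = λ v i → innerPt⇒innerCell (φ a (sub v)) (D2-in a v i)
        ; labelled   = λ v i eq → ptLabel⇒cellLabel (φ a (sub v)) (D3 a v i eq)
        ; injective  = λ x y c i₁ i₂ → D4 a x y (fz , c) (image x c i₁) (image y c i₂)
        }
        where
        image : ∀ x c → CellImage (cellOf ∘ φ a) x c → Img F (T ∷ []) φ a x (fz , c)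
        image (vert x) c refl = point-η (φ a x)
        image (edge v) c (v<c , c<parent) =
          subst (λ q → PLt (T ∷ []) q (fz , c)) (sym (point-η (φ a (sub v)))) (<c⇒PLt v<c) ,
          subst (PLt (T ∷ []) (fz , c)) (sym (point-η (φ a (parent v)))) (<c⇒PLt c<parent)

      toEmbedding : Σ (Emb (lookup F a) T) λ e → ∀ v → φ a (sub v) ≡ (fz , embCell e (sub v))
      toEmbedding with e , induced ← isTreeMap⇒emb (lookup F a) ≤F-isTreeMap =
        e , λ v → trans (point-η (φ a (sub v))) (cong (fz ,_) (induced v))

  PLe-sameTree : ∀ {G : Forest {n}} {p q : Point G} → PLe G p q → proj₁ p ≡ proj₁ q
  PLe-sameTree (same _) = refl

  ptLabel⇒leaf : ∀ (G : Forest {n}) (p : Point G) {i} → ptLabel G p ≡ just i → i ∈ leaves (lookup G (proj₁ p))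
  ptLabel⇒leaf G (k , pt (sub w)) eq = label⇒leaf w eq
  ptLabel⇒leaf G (k , pt rootV)   ()
  ptLabel⇒leaf G (k , lo _)       ()
  ptLabel⇒leaf G (k , mid _)      ()
  ptLabel⇒leaf G (k , hi _)       ()

  module _ {F G : Forest {n}} (F≤G : F ≤F G) where
    open _≤F_ F≤G

    treeOf : Fin (length F) → Fin (length G)
    treeOf a = proj₁ (φ a rootV)

    ≤F-leaves : ∀ a → leaves (lookup F a) ⊆ leaves (lookup G (treeOf a))
    ≤F-leaves a i∈F with v , v↦i ← leaf-vertex (lookup F a) i∈F =
      subst (λ k → _ ∈ leaves (lookup G k)) (sameTree v) (ptLabel⇒leaf G (φ a (sub v)) (D3 a v _ v↦i))
      where
      sameTree : ∀ v → proj₁ (φ a (sub v)) ≡ treeOf a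
      sameTree = fromRoot-induction (λ x → proj₁ (φ a x) ≡ treeOf a) refl
                                    (λ v eq → trans (PLe-sameTree (D1 a v)) eq)

  Π-monotone : ∀ {F G : Forest {n}} → F ≤F G → Π F ≤r Π G
  Π-monotone {F} {G} F≤G = Allₚ.map⁺ (All.tabulate λ t∈F →
    subst (λ t → Any (leaves t ⊆_) (Π G)) (sym (Anyₚ.lookup-index t∈F)) (covered (Any.index t∈F)))
    where
    covered : ∀ a → Any (leaves (lookup F a) ⊆_) (Π G)
    covered a = lose (∈-map⁺ leaves (∈-lookup (treeOf F≤G a))) (≤F-leaves F≤G a)

  emb-covers-meet : ∀ {t s : Tree n} → DistinctLeaves s → (e : Emb t s) → ∀ {v} → InS s v (leaves t) →
                    ∃ λ x → IsInner x × emb e x ≡ v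
  emb-covers-meet {t} d e (i , j , i∈t , j∈t , i≢j , v-meet) with x , x-meet ← meet-exists t i∈t j∈t i≢j =
    x , meet-inner x-meet , meet-unique d (emb-meet e x-meet) v-meet

  Π-admissible : ∀ {T : Tree n} → DistinctLeaves T → (F : Forest {n}) → IsForestOn F → F ≤F (T ∷ []) →
                 Admissible T (Π F)
  Π-admissible {T} dT F isF F≤T = (isF , Allₚ.map⁺ (All.universal leaves-nonEmpty F)) , disjoint
    where
    open _≤F_ F≤T
    covered : ∀ a v → InS T v (lookup (Π F) a) →
              ∃ λ x → IsInner x × φ (mapIndex leaves F a) (sub x) ≡ (fz , pt (sub v))
    covered a v v∈S
      with e , φ≡e ← toEmbedding F≤T (mapIndex leaves F a)
      with x , inner , x↦v ← emb-covers-meet dT e (subst (InS T v) (lookup-map leaves F a) v∈S) =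
      x , inner , trans (φ≡e x) (cong (λ w → fz , pt (sub w)) x↦v)
    disjoint : ∀ a b → a ≢ b → ∀ v → InS T v (lookup (Π F) a) → InS T v (lookup (Π F) b) → ⊥
    disjoint a b a≢b v inA inB with x , ix , φx ← covered a v inA | y , iy , φy ← covered b v inB =
      a≢b (mapIndex-injective leaves F (cong proj₁ (D2-inj _ _ x y ix iy (trans φx (sym φy)))))

  Π-reflects : ∀ {T : Tree n} → DistinctLeaves T → {F G : Forest {n}} → F ≤F (T ∷ []) → G ≤F (T ∷ []) →
               Π F ≤r Π G → F ≤F G
  Π-reflects {T} dT {F} {G} F≤T G≤T F≤rG = fromEmbeddings record
    { tree = tree ; embedding = embedding ; inner-injective = inner-injective }
    where
    open _≤F_ F≤T
    cover : ∀ a → Any (λ u → leaves (lookup F a) ⊆ leaves u) G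
    cover a = Anyₚ.map⁻ (All.lookup (Allₚ.map⁻ F≤rG) (∈-lookup a))
    tree : Fin (length F) → Fin (length G)
    tree a = Any.index (cover a)
    embF = λ a → proj₁ (toEmbedding F≤T a)
    embG = λ b → proj₁ (toEmbedding G≤T b)
    factorisation : ∀ a → Factors (embF a) (embG (tree a))
    factorisation a = factor dT (embF a) (embG (tree a)) (Anyₚ.lookup-index (cover a))
    embedding : ∀ a → Emb (lookup F a) (lookup G (tree a))
    embedding a = proj₁ (factorisation a)
    -- Only ever applied to vertex cells.
    vertexOf : ∀ {s : Tree n} → Cell s → V s
    vertexOf (pt x) = x
    vertexOf _      = rootV
    toT : Point G → Point (T ∷ [])
    toT (b , c) = fz , embCell (embG b) (vertexOf c)
    toT-embedding : ∀ a v → toT (tree a , pt (sub (emb (embedding a) v))) ≡ φ a (sub v)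
    toT-embedding a v = begin
      fz , pt (sub (emb (embG (tree a)) (emb (embedding a) v)))
        ≡⟨ cong (λ w → fz , pt (sub w)) (proj₂ (factorisation a) v) ⟩
      fz , pt (sub (emb (embF a) v))
        ≡⟨ sym (proj₂ (toEmbedding F≤T a) v) ⟩
      φ a (sub v)
        ∎
      where open ≡-Reasoning
    inner-injective : ∀ a b (v : Vtx (lookup F a)) (w : Vtx (lookup F b)) → IsInner v → IsInner w →
                      _≡_ {A = Point G} (tree a , pt (sub (emb (embedding a) v)))
                                        (tree b , pt (sub (emb (embedding b) w))) →
                      _≡_ {A = Σ (Fin (length F)) (λ c → Vtx (lookup F c))} (a , v) (b , w)
    inner-injective a b v w iv iw eq =
      D2-inj a b v w iv iw (trans (sym (toT-embedding a v)) (trans (cong toT eq) (toT-embedding b w)))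

  blocks-unique : ∀ (π : List (List (Fin n))) → Unique (concat π) → All Unique π
  blocks-unique []      _ = []
  blocks-unique (B ∷ π) u with u-B , u-π , _ ← Unique-++⁻ B u = u-B ∷ blocks-unique π u-π

  unique-sameElements⇒↭ : ∀ {xs ys : List (Fin n)} → Unique xs → Unique ys → xs ⊆ ys → ys ⊆ xs → xs ↭ ys
  unique-sameElements⇒↭ u-xs u-ys xs⊆ys ys⊆xs = ∼bag⇒↭ (unique∧set⇒bag u-xs u-ys (mk⇔ xs⊆ys ys⊆xs))

  emb-inner-InS : ∀ {t s : Tree n} {B : List (Fin n)} → DistinctLeaves s → (e : Emb t s) → leaves t ⊆ B →
                  ∀ x → IsInner x → InS s (emb e x) B
  emb-inner-InS d e t⊆B x inner with i , j , x-meet ← inner⇒meet x inner =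
    i , j , t⊆B (proj₁ (meet-leaves x-meet)) , t⊆B (proj₂ (meet-leaves x-meet)) ,
    meet-distinct d (emb-meet e x-meet) , emb-meet e x-meet

  restrictions : Tree n → List (List (Fin n)) → Forest {n}
  restrictions T π = map (restrictedTree T) π

  module _ (T : Tree n) (isT : IsTreeOn T) where

    leaves-complete : ∀ {B : List (Fin n)} → B ⊆ leaves T
    leaves-complete {_} {i} _ = ∈-resp-↭ (↭-sym isT) (∈-allFin i)

    restrictions-isForestOn : ∀ π → IsPartition π → IsForestOn (restrictions T π)
    restrictions-isForestOn π (π↭I , nonEmpty) =
      ↭-trans (leaves↭blocks π nonEmpty (blocks-unique π (↭allFin⇒unique π↭I))) π↭I
      where
      leaves↭blocks : ∀ ρ → All NonEmpty ρ → All Unique ρ → concat (Π (restrictions T ρ)) ↭ concat ρ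
      leaves↭blocks []      _          _        = ↭-refl
      leaves↭blocks (B ∷ ρ) (ne ∷ nes) (u ∷ us) =
        ↭-++⁺ (unique-sameElements⇒↭ unique-restricted u (restricted-⊆ T B ne leaves-complete)
                                                           (restricted-⊇ T B leaves-complete))
              (leaves↭blocks ρ nes us)
        where
        unique-restricted = distinct⇒unique _ (distinct-emb (isTreeOn⇒distinct isT) (restricted-emb T B))

    Π-restrictions-≤r : ∀ π → All NonEmpty π → Π (restrictions T π) ≤r π
    Π-restrictions-≤r π nonEmpty = Allₚ.map⁺ (Allₚ.map⁺ (All.tabulate λ {B} B∈π →
      lose B∈π (restricted-⊆ T B (All.lookup nonEmpty B∈π) leaves-complete)))

    ≤r-Π-restrictions : ∀ π → π ≤r Π (restrictions T π)
    ≤r-Π-restrictions π = All.tabulate λ {B} B∈π →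
      lose (∈-map⁺ leaves (∈-map⁺ (restrictedTree T) B∈π)) (restricted-⊇ T B leaves-complete)

    restrictions-below : ∀ π → Admissible T π → restrictions T π ≤F (T ∷ [])
    restrictions-below π ((_ , nonEmpty) , admissible) =
      fromEmbeddings record { tree = λ _ → fz ; embedding = embedding ; inner-injective = inner-injective }
      where
      F = restrictions T π
      dT = isTreeOn⇒distinct isT
      block : Fin (length F) → Fin (length π)
      block = mapIndex (restrictedTree T) π
      embedding : ∀ a → Emb (lookup F a) T
      embedding a = subst (λ u → Emb u T) (sym (lookup-map (restrictedTree T) π a))
                          (restricted-emb T (lookup π (block a)))
      inner-in-block : ∀ a v → IsInner v → InS T (emb (embedding a) v) (lookup π (block a))
      inner-in-block a = emb-inner-InS dT (embedding a) leaves⊆block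
        where
        leaves⊆block = subst (λ u → leaves u ⊆ lookup π (block a)) (sym (lookup-map (restrictedTree T) π a))
                             (restricted-⊆ T _ (All.lookup nonEmpty (∈-lookup (block a))) leaves-complete)
      inner-injective : ∀ a b (v : Vtx (lookup F a)) (w : Vtx (lookup F b)) → IsInner v → IsInner w →
                        _≡_ {A = Point (T ∷ [])} (fz , pt (sub (emb (embedding a) v)))
                                                 (fz , pt (sub (emb (embedding b) w))) →
                        _≡_ {A = Σ (Fin (length F)) (λ c → Vtx (lookup F c))} (a , v) (b , w)
      inner-injective a b v w iv iw eq with a Fin.≟ b
      ... | yes refl = cong (a ,_) (emb-injective (embedding a) ev≡ew)
        where ev≡ew = pt-sub-injective (,-injectiveʳ eq)
      ... | no a≢b = ⊥-elim (admissible (block a) (block b) (a≢b ∘ mapIndex-injective (restrictedTree T) π)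
                               (emb (embedding a) v) (inner-in-block a v iv) in-block-b)
        where
        in-block-b = subst (λ x → InS T x (lookup π (block b))) (sym (pt-sub-injective (,-injectiveʳ eq)))
                           (inner-in-block b w iw)

  Π-surjective : ∀ {T : Tree n} → IsTreeOn T → ∀ π → Admissible T π →
                 ∃ λ (F : Forest {n}) → IsForestOn F × F ≤F (T ∷ []) × Π F ≤r π × π ≤r Π F
  Π-surjective {T} isT π adm@(partition@(_ , nonEmpty) , _) =
    restrictions T π , restrictions-isForestOn T isT π partition , restrictions-below T isT π adm ,
    Π-restrictions-≤r T isT π nonEmpty , ≤r-Π-restrictions T isT π

mainTheorem2 : ∀ {n : ℕ} (T : Tree n) → IsTreeOn T →
    ((∀ (F : Forest) → IsForestOn F → F ≤F (T ∷ []) → Admissible T (Π F))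
    × (∀ (F G : Forest) → IsForestOn F → IsForestOn G →
         F ≤F (T ∷ []) → G ≤F (T ∷ []) →
         ((F ≤F G → Π F ≤r Π G) × (Π F ≤r Π G → F ≤F G)))
    × (∀ π → Admissible T π →
         ∃ λ (F : Forest) → IsForestOn F × F ≤F (T ∷ []) × Π F ≤r π × π ≤r Π F))
mainTheorem2 T isT =
  Π-admissible (isTreeOn⇒distinct isT) ,
  (λ F G _ _ F≤T G≤T → Π-monotone , Π-reflects (isTreeOn⇒distinct isT) F≤T G≤T) ,
  Π-surjective isT
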